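{- Continuously topo-bisimilar states satisfy the same modal formulae: if $M,w \rightleftharpoons M',w'$ then for every formula $\varphi$, $M,w\models\varphi$ iff $M',w'\models\varphi$.
   Context: Formulas are built from propositional variables using $\wedge$, a negation, and $\Box$ (dual $\Diamond$). A paraconsistent topological model $\langle S,\sigma,V\rangle$ has $\sigma$ a closed set topology, $V(p)$ closed, and $[p]=V(p)$, $[\varphi\wedge\psi]=[\varphi]\cap[\psi]$, $[\sim\varphi]=\mathsf{Clo}(S\setminus[\varphi])$, $[\Box\varphi]=\mathsf{Int}([\varphi])$, $[\Diamond\varphi]=\mathsf{Clo}([\varphi])$; a paracomplete topological model has an open set topology, $V(p)$ open, and negation $\dot{\sim}$ with $[\dot{\sim}\varphi]=\mathsf{Int}(S\setminus[\varphi])$. Topo-bisimulation between topological models $\langle S,\sigma,V\rangle$ and $\langle S',\sigma',V'\rangle$: a relation $Z\subseteq S\times S'$ such that whenever $sZs'$: (1) $s,s'$ satisfy the same propositional variables; (2) for every open $O\ni s$ there is an open $O'\ni s'$ such that every $t'\in O'$ has some $t\in O$ with $tZt'$; (3) for every open $O'\ni s'$ there is an open $O\ni s$ such that every $t\in O$ has some $t'\in O'$ with $tZt'$. For two paraconsistent (respectively paracomplete) topological models $M=\langle S,\sigma,V\rangle$, $M'=\langle S',\sigma',V'\rangle$, $M,w$ and $M',w'$ are continuously topo-bisimilar ($M,w\rightleftharpoons M',w'$) if they are topo-bisimilar and there is a homeomorphism $f$ between $\langle S,\sigma\rangle$ and $\langle S',\sigma'\rangle$ with $V'(p)=f(V(p))$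 for all $p$. -}

module Defs where

open import Data.Nat using (ℕ)
open import Data.Bool using (Bool; true; false; not; _∧_)
open import Data.Product using (Σ; ∃; _×_; _,_)
open import Function.Bundles using (_⇔_)
open import Relation.Binary.PropositionalEquality using (_≡_)

Subset : Set → Set
Subset S = S → Bool

_∈_ : {S : Set} → S → Subset S → Set
x ∈ A = A x ≡ true

_⊆_ : {S : Set} → Subset S → Subset S → Set
A ⊆ B = ∀ x → x ∈ A → x ∈ B

∁ : {S : Set} → Subset S → Subset S
∁ A x = not (A x)

record Topology (S : Set) : Set₁ where
  field
    Open   : Subset S → Set
    open-∅ : Open (λ _ → false)
    open-S : Open (λ _ → true)
    open-∩ : ∀ {U W} → Open U → Open W → Open (λ x → U x ∧ W x)
    open-⋃ : ∀ {I : Set} (F : I → Subset S) → (∀ i → Open (F i)) →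
             (U : Subset S) → (∀ x → (x ∈ U) ⇔ (∃ λ i → x ∈ F i)) → Open U
    Int     : Subset S → Subset S
    Int-open : ∀ A → Open (Int A)
    Int-⊆   : ∀ A → Int A ⊆ A
    Int-max : ∀ A U → Open U → U ⊆ A → U ⊆ Int A
    Clo      : Subset S → Subset S
    Clo-closed : ∀ A → Open (∁ (Clo A))
    Clo-⊇    : ∀ A → A ⊆ Clo A
    Clo-min  : ∀ A C → Open (∁ C) → A ⊆ C → Clo A ⊆ C

  Closed : Subset S → Set
  Closed A = Open (∁ A)

open Topology public

data Form : Set where
  var  : ℕ → Form
  _∧'_ : Form → Form → Form
  ~_   : Form → Form
  □_   : Form → Form
  ◇_   : Form → Form

record TopModel : Set₁ where
  field
    S   : Set
    τ   : Topology S
    V   : ℕ → Subset S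

open TopModel public

IsParaconsistent : TopModel → Set
IsParaconsistent M = ∀ p → Closed (τ M) (V M p)

IsParacomplete : TopModel → Set
IsParacomplete M = ∀ p → Open (τ M) (V M p)

⟦_⟧c : Form → (M : TopModel) → Subset (S M)
⟦ var p ⟧c M = V M p
⟦ φ ∧' ψ ⟧c M = λ x → ⟦ φ ⟧c M x ∧ ⟦ ψ ⟧c M x
⟦ ~ φ ⟧c M = Clo (τ M) (∁ (⟦ φ ⟧c M))
⟦ □ φ ⟧c M = Int (τ M) (⟦ φ ⟧c M)
⟦ ◇ φ ⟧c M = Clo (τ M) (⟦ φ ⟧c M)

⟦_⟧o : Form → (M : TopModel) → Subset (S M)
⟦ var p ⟧o M = V M p
⟦ φ ∧' ψ ⟧o M = λ x → ⟦ φ ⟧o M x ∧ ⟦ ψ ⟧o M x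
⟦ ~ φ ⟧o M = Int (τ M) (∁ (⟦ φ ⟧o M))
⟦ □ φ ⟧o M = Int (τ M) (⟦ φ ⟧o M)
⟦ ◇ φ ⟧o M = Clo (τ M) (⟦ φ ⟧o M)

_,_⊨c_ : (M : TopModel) → S M → Form → Set
M , w ⊨c φ = w ∈ ⟦ φ ⟧c M

_,_⊨o_ : (M : TopModel) → S M → Form → Set
M , w ⊨o φ = w ∈ ⟦ φ ⟧o M

record IsTopoBisim (M M' : TopModel) (Z : S M → S M' → Set) : Set₁ where
  field
    atoms : ∀ s s' → Z s s' → ∀ p → (s ∈ V M p) ⇔ (s' ∈ V M' p)
    forth : ∀ s s' → Z s s' → ∀ O → Open (τ M) O → s ∈ O →
            Σ (Subset (S M')) λ O' → Open (τ M') O' × s' ∈ O' ×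
              (∀ t' → t' ∈ O' → Σ (S M) λ t → t ∈ O × Z t t')
    back  : ∀ s s' → Z s s' → ∀ O' → Open (τ M') O' → s' ∈ O' →
            Σ (Subset (S M)) λ O → Open (τ M) O × s ∈ O ×
              (∀ t → t ∈ O → Σ (S M') λ t' → t' ∈ O' × Z t t')

TopoBisimilar : (M : TopModel) → S M → (M' : TopModel) → S M' → Set₁
TopoBisimilar M w M' w' =
  Σ (S M → S M' → Set) λ Z → IsTopoBisim M M' Z × Z w w'

record Homeomorphism (M M' : TopModel) : Set₁ where
  field
    f    : S M → S M'
    g    : S M' → S M
    g∘f  : ∀ x → g (f x) ≡ x
    f∘g  : ∀ y → f (g y) ≡ y
    f-cont : ∀ U' → Open (τ M') U' → Open (τ M) (λ x → U' (f x))
    g-cont : ∀ U → Open (τ M) U → Open (τ M') (λ y → U (g y))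

image : {A B : Set} → (A → B) → Subset A → B → Set
image {A} f X y = Σ A λ x → f x ≡ y × x ∈ X

ContTopoBisimilar : (M : TopModel) → S M → (M' : TopModel) → S M' → Set₁
ContTopoBisimilar M w M' w' =
  TopoBisimilar M w M' w' ×
  Σ (Homeomorphism M M') λ h →
    ∀ p y → (y ∈ V M' p) ⇔ image (Homeomorphism.f h) (V M p) y

module Submission where

-- Subsets are Boolean-valued, so a pair of subsets A ⊆ S, A' ⊆ S' is
-- "Z-invariant" when A t ≡ A' t' for all t Z t'.  The truth lemma says
-- that the pair of denotations of every formula is Z-invariant; it is
-- proved by induction on the formula.  Atoms are invariant by the atom
-- clause, and invariance is preserved by complement and intersection
-- (pointwise Boolean operations), by interior (using the forth clause)
-- and by closure (using the back clause, via the characterisation of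
-- the closure as the set of points all of whose open neighbourhoods meet
-- the set).  Each topological step is proved in one direction only; the
-- other follows because the converse of a topo-bisimulation is again one.

open import Defs
open import Data.Bool using (true; false; not; _∧_)
open import Data.Bool.Properties using (not-involutive; ⇔→≡)
open import Data.Empty using (⊥-elim)
open import Data.Product using (_×_; _,_)
open import Data.Unit using (⊤; tt)
open import Function using (flip)
open import Function.Bundles using (_⇔_; mk⇔)
open import Function.Properties.Equivalence using () renaming (sym to ⇔-sym)
open import Relation.Nullary using (¬_)
open import Relation.Binary.PropositionalEquality
  using (_≡_; refl; sym; trans; cong; cong₂)

∈∁⇒∉ : ∀ {S : Set} {A : Subset S} {x : S} → x ∈ ∁ A → ¬ (x ∈ A)
∈∁⇒∉ {A = A} {x} = lemma (A x)
  where
  lemma : ∀ b → not b ≡ true → ¬ (b ≡ true)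
  lemma true  () _
  lemma false _  ()

∉⇒∈∁ : ∀ {S : Set} {A : Subset S} {x : S} → ¬ (x ∈ A) → x ∈ ∁ A
∉⇒∈∁ {A = A} {x} = lemma (A x)
  where
  lemma : ∀ b → ¬ (b ≡ true) → not b ≡ true
  lemma true  b≢true = ⊥-elim (b≢true refl)
  lemma false _      = refl

Disjoint : {S : Set} → Subset S → Subset S → Set
Disjoint O A = ∀ t → t ∈ O → ¬ (t ∈ A)

module ClosureViaNeighbourhoods {S : Set} (T : Topology S) where

  Adherent : Subset S → S → Set
  Adherent A x = ∀ O → Open T O → x ∈ O → ¬ Disjoint O A

  -- Openness only depends on the subset pointwise (a one-member union).
  open-ext : ∀ {U W} → Open T U → (∀ x → U x ≡ W x) → Open T W
  open-ext {U} {W} U-open U≗W =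
    open-⋃ T {I = ⊤} (λ _ → U) (λ _ → U-open) W
      (λ x → mk⇔ (λ x∈W → tt , trans (U≗W x) x∈W)
                 (λ { (_ , x∈U) → trans (sym (U≗W x)) x∈U }))

  ∁-open-closed : ∀ {O} → Open T O → Closed T (∁ O)
  ∁-open-closed {O} O-open = open-ext O-open (λ x → sym (not-involutive (O x)))

  -- Points of the closure adhere: if an open O ∋ x missed A, its closed
  -- complement would contain A, hence Clo A, hence x.
  clo⇒adherent : ∀ {A x} → x ∈ Clo T A → Adherent A x
  clo⇒adherent {A} {x} x∈ClA O O-open x∈O O∩A=∅ =
    ∈∁⇒∉ {A = O} (Clo-min T A (∁ O) (∁-open-closed O-open) A⊆∁O x x∈ClA) x∈O
    where
    A⊆∁O : A ⊆ ∁ O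
    A⊆∁O t t∈A = ∉⇒∈∁ {A = O} (λ t∈O → O∩A=∅ t t∈O t∈A)

  -- Adherent points lie in the closure: otherwise the open complement of
  -- Clo A would be a neighbourhood of x disjoint from A ⊆ Clo A.
  adherent⇒clo : ∀ {A x} → Adherent A x → x ∈ Clo T A
  adherent⇒clo {A} {x} x-adh with Clo T A x in x∉ClA
  ... | true  = refl
  ... | false = ⊥-elim (x-adh (∁ (Clo T A)) (Clo-closed T A) (cong not x∉ClA)
                         (λ t t∈∁ClA t∈A → ∈∁⇒∉ {A = Clo T A} t∈∁ClA (Clo-⊇ T A t t∈A)))

open ClosureViaNeighbourhoods

converse : ∀ {M M' Z} → IsTopoBisim M M' Z → IsTopoBisim M' M (flip Z)
converse B = record
  { atoms = λ s' s sZs' p → ⇔-sym (atoms s s' sZs' p)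
  ; forth = λ s' s sZs' → back s s' sZs'
  ; back  = λ s' s sZs' → forth s s' sZs'
  }
  where open IsTopoBisim B

Invariant : {S S' : Set} → (S → S' → Set) → Subset S → Subset S' → Set
Invariant Z A A' = ∀ t t' → Z t t' → A t ≡ A' t'

invariant-converse : ∀ {S S' : Set} {Z : S → S' → Set} {A A'} →
                     Invariant Z A A' → Invariant (flip Z) A' A
invariant-converse A≈A' t' t tZt' = sym (A≈A' t t' tZt')

module _ {M M' : TopModel} {Z : S M → S M' → Set} (B : IsTopoBisim M M' Z) where
  open IsTopoBisim B

  -- Forth clause: the open set Int A around s yields an open O' around s'
  -- whose points are Z-related to points of A; by invariance O' ⊆ A', and
  -- an open subset of A' lies in Int A'.
  int-forth : ∀ {A A'} → Invariant Z A A' →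
              ∀ {s s'} → Z s s' → s ∈ Int (τ M) A → s' ∈ Int (τ M') A'
  int-forth {A} {A'} A≈A' {s} {s'} sZs' s∈IntA
    with forth s s' sZs' (Int (τ M) A) (Int-open (τ M) A) s∈IntA
  ... | O' , O'-open , s'∈O' , O'⊆Z[IntA] =
    Int-max (τ M') A' O' O'-open O'⊆A' s' s'∈O'
    where
    O'⊆A' : O' ⊆ A'
    O'⊆A' t' t'∈O' with O'⊆Z[IntA] t' t'∈O'
    ... | t , t∈IntA , tZt' = trans (sym (A≈A' t t' tZt')) (Int-⊆ (τ M) A t t∈IntA)

  -- Back clause: an open O' around s' disjoint from A' pulls back to an
  -- open O around s disjoint from A, contradicting s ∈ Clo A.
  clo-forth : ∀ {A A'} → Invariant Z A A' →
              ∀ {s s'} → Z s s' → s ∈ Clo (τ M) A → s' ∈ Clo (τ M') A'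
  clo-forth {A} {A'} A≈A' {s} {s'} sZs' s∈ClA =
    adherent⇒clo (τ M') λ O' O'-open s'∈O' O'∩A'=∅ →
      let (O , O-open , s∈O , O⊆Z⁻¹[O']) = back s s' sZs' O' O'-open s'∈O'
          O∩A=∅ : Disjoint O A
          O∩A=∅ t t∈O t∈A =
            let (t' , t'∈O' , tZt') = O⊆Z⁻¹[O'] t t∈O
            in O'∩A'=∅ t' t'∈O' (trans (sym (A≈A' t t' tZt')) t∈A)
      in clo⇒adherent (τ M) s∈ClA O O-open s∈O O∩A=∅

module _ {M M' : TopModel} {Z : S M → S M' → Set} where

  ∁-invariant : ∀ {A A'} → Invariant Z A A' → Invariant Z (∁ A) (∁ A')
  ∁-invariant A≈A' t t' tZt' = cong not (A≈A' t t' tZt')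

  ∩-invariant : ∀ {A A' C C'} → Invariant Z A A' → Invariant Z C C' →
                Invariant Z (λ x → A x ∧ C x) (λ x → A' x ∧ C' x)
  ∩-invariant A≈A' C≈C' t t' tZt' = cong₂ _∧_ (A≈A' t t' tZt') (C≈C' t t' tZt')

  int-invariant : IsTopoBisim M M' Z → ∀ {A A'} → Invariant Z A A' →
                  Invariant Z (Int (τ M) A) (Int (τ M') A')
  int-invariant B A≈A' t t' tZt' = ⇔→≡ (mk⇔
    (int-forth B A≈A' tZt')
    (int-forth (converse B) (invariant-converse A≈A') tZt'))

  clo-invariant : IsTopoBisim M M' Z → ∀ {A A'} → Invariant Z A A' →
                  Invariant Z (Clo (τ M) A) (Clo (τ M') A')
  clo-invariant B A≈A' t t' tZt' = ⇔→≡ (mk⇔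
    (clo-forth B A≈A' tZt')
    (clo-forth (converse B) (invariant-converse A≈A') tZt'))

  atom-invariant : IsTopoBisim M M' Z → ∀ p → Invariant Z (V M p) (V M' p)
  atom-invariant B p t t' tZt' = ⇔→≡ (IsTopoBisim.atoms B t t' tZt' p)

  truth-c : IsTopoBisim M M' Z → ∀ φ → Invariant Z (⟦ φ ⟧c M) (⟦ φ ⟧c M')
  truth-c B (var p)  = atom-invariant B p
  truth-c B (φ ∧' ψ) = ∩-invariant (truth-c B φ) (truth-c B ψ)
  truth-c B (~ φ)    = clo-invariant B (∁-invariant (truth-c B φ))
  truth-c B (□ φ)    = int-invariant B (truth-c B φ)
  truth-c B (◇ φ)    = clo-invariant B (truth-c B φ)

  truth-o : IsTopoBisim M M' Z → ∀ φ → Invariant Z (⟦ φ ⟧o M) (⟦ φ ⟧o M')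
  truth-o B (var p)  = atom-invariant B p
  truth-o B (φ ∧' ψ) = ∩-invariant (truth-o B φ) (truth-o B ψ)
  truth-o B (~ φ)    = int-invariant B (∁-invariant (truth-o B φ))
  truth-o B (□ φ)    = int-invariant B (truth-o B φ)
  truth-o B (◇ φ)    = clo-invariant B (truth-o B φ)

invariant-⇔ : ∀ {S S' : Set} {Z : S → S' → Set} {A A'} → Invariant Z A A' →
              ∀ {w w'} → Z w w' → (w ∈ A) ⇔ (w' ∈ A')
invariant-⇔ A≈A' {w} {w'} wZw' =
  mk⇔ (trans (sym (A≈A' w w' wZw'))) (trans (A≈A' w w' wZw'))

bisimilar-⊨c : ∀ {M M' w w'} → TopoBisimilar M w M' w' →
               ∀ φ → (M , w ⊨c φ) ⇔ (M' , w' ⊨c φ)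
bisimilar-⊨c (Z , B , wZw') φ = invariant-⇔ (truth-c B φ) wZw'

bisimilar-⊨o : ∀ {M M' w w'} → TopoBisimilar M w M' w' →
               ∀ φ → (M , w ⊨o φ) ⇔ (M' , w' ⊨o φ)
bisimilar-⊨o (Z , B , wZw') φ = invariant-⇔ (truth-o B φ) wZw'

theorem3p16 : ((M M' : TopModel) → IsParaconsistent M → IsParaconsistent M' →
    (w : S M) (w' : S M') → ContTopoBisimilar M w M' w' →
    ∀ φ → (M , w ⊨c φ) ⇔ (M' , w' ⊨c φ))
    ×
    ((M M' : TopModel) → IsParacomplete M → IsParacomplete M' →
    (w : S M) (w' : S M') → ContTopoBisimilar M w M' w' →
    ∀ φ → (M , w ⊨o φ) ⇔ (M' , w' ⊨o φ))
theorem3p16 =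
  (λ M M' _ _ w w' (bisim , _) → bisimilar-⊨c bisim) ,
  (λ M M' _ _ w w' (bisim , _) → bisimilar-⊨o bisim)
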